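{- For every integer $n\ge1$, $$\prod_{\substack{1\le k<3n\\ k\equiv 1,5 \ (\mathrm{mod}\ 6)}}\Bigl(1+\frac{1}{3k}\Bigr)<1.5\,n^{1/9}.$$ -}

module Defs where

open import Data.Nat as ℕ using (ℕ; zero; suc; _%_)
open import Data.Nat.Properties using (_≟_)
open import Data.Integer using (+_)
open import Data.Rational using (ℚ; 1ℚ; _/_; _+_; _*_)
open import Data.List using (List; upTo; filter; map; foldr)
open import Data.Sum using (_⊎_)
open import Relation.Nullary.Decidable using (_⊎-dec_)
open import Relation.Binary.PropositionalEquality using (_≡_)

Cond : ℕ → Set
Cond k = k % 6 ≡ 1 ⊎ k % 6 ≡ 5

cond? : (k : ℕ) → Relation.Nullary.Decidable.Dec (Cond k)
cond? k = (k % 6 ≟ 1) ⊎-dec (k % 6 ≟ 5)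

-- the factor 1 + 1/(3k); k = 0 never occurs (0 is not ≡ 1,5 mod 6)
term : ℕ → ℚ
term zero    = 1ℚ
term (suc j) = 1ℚ + (+ 1 / (3 ℕ.* suc j))

prodP : ℕ → ℚ
prodP n = foldr _*_ 1ℚ (map term (filter cond? (upTo (3 ℕ.* n))))

_^ℚ_ : ℚ → ℕ → ℚ
q ^ℚ zero  = 1ℚ
q ^ℚ suc m = q * (q ^ℚ m)

{-# OPTIONS --safe #-}
module Submission where

-- Going from n to n + 1 adds the block 3n, 3n + 1, 3n + 2, which contains exactly
-- one k ≡ 1, 5 (mod 6), namely k = 3n + 1 + (n mod 2) > 3n; so P(n) = num n / den n
-- with num n = ∏ (3k + 1) and den n = ∏ 3k. Bernoulli's inequality in the form
-- (1 + 1/m)^e ≤ m/(m − e), with m = 3k > 9n, gives (1 + 1/(3k))^9 ≤ (3n + 1)/(3n − 2).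
-- Hence P(n)^9 · 3/(3n − 2) does not increase from n = 2 on, and P(2) = 64/45 yields
-- P(n)^9 ≤ (3/2)^9 (n − 2/3) < (3/2)^9 n; n = 1 is checked directly.

open import Level using (Level)
open import Algebra.Bundles using (Monoid)
open import Function using (_∘_)
open import Data.Unit using (tt)
open import Data.Sum as Sum using ()
open import Data.List using ([]; _∷_; _++_; _∷ʳ_; upTo; filter; map; foldr)
open import Data.List.Properties using (upTo-∷ʳ; filter-++; filter-accept; filter-reject; map-++; ++-identityʳ)
open import Data.Nat using (ℕ; zero; suc; NonZero; _≤_)
import Data.Nat as ℕ
open import Data.Nat.Properties using (m*n≢0; m^n≢0)
open import Data.Integer using (+_; +<+)
import Data.Integer as ℤ
open import Data.Integer.Properties using (pos-*)
import Data.Rational as ℚ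
open import Data.Rational using (1ℚ)
open import Data.Rational.Properties using (*-1-monoid; toℚᵘ-fromℚᵘ; toℚᵘ-homo-*; toℚᵘ-homo-+; toℚᵘ-cancel-<)
open import Data.Rational.Unnormalised using (mkℚᵘ; *≡*; *<*) renaming (_≃_ to _≃ᵘ_)
import Data.Rational.Unnormalised.Properties as ℚᵘ
open import Data.Rational.Unnormalised.Properties using (≃-refl; ≃-sym; ≃-trans; ≃-reflexive; <-respˡ-≃; <-respʳ-≃)
open import Relation.Nullary using (¬_)
open import Relation.Unary using (Pred; Decidable)
open import Relation.Binary.PropositionalEquality using (_≡_; refl; cong; module ≡-Reasoning)
import Relation.Binary.PropositionalEquality as ≡
import Relation.Binary.Reasoning.Setoid as SetoidReasoning

open import Defs

private variable a c ℓ p : Level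

module _ {A : Set a} {P : Pred A p} (P? : Decidable P) where

  filter-∷ʳ-accept : ∀ {x} xs → P x → filter P? (xs ∷ʳ x) ≡ filter P? xs ∷ʳ x
  filter-∷ʳ-accept {x} xs Px =
    ≡.trans (filter-++ P? xs (x ∷ [])) (cong (filter P? xs ++_) (filter-accept P? Px))

  filter-∷ʳ-reject : ∀ {x} xs → ¬ P x → filter P? (xs ∷ʳ x) ≡ filter P? xs
  filter-∷ʳ-reject {x} xs ¬Px = begin
    filter P? (xs ∷ʳ x)                 ≡⟨ filter-++ P? xs (x ∷ []) ⟩
    filter P? xs ++ filter P? (x ∷ [])  ≡⟨ cong (filter P? xs ++_) (filter-reject P? ¬Px) ⟩
    filter P? xs ++ []                  ≡⟨ ++-identityʳ (filter P? xs) ⟩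
    filter P? xs                        ∎
    where open ≡-Reasoning

module _ (M : Monoid c ℓ) where
  open Monoid M using (_≈_; _∙_; ε; ∙-congˡ; assoc; identityˡ; identityʳ; setoid)
  open SetoidReasoning setoid

  foldr-∷ʳ : ∀ xs x → foldr _∙_ ε (xs ∷ʳ x) ≈ foldr _∙_ ε xs ∙ x
  foldr-∷ʳ []       x = begin
    x ∙ ε  ≈⟨ identityʳ x ⟩
    x      ≈⟨ identityˡ x ⟨
    ε ∙ x  ∎
  foldr-∷ʳ (y ∷ ys) x = begin
    y ∙ foldr _∙_ ε (ys ∷ʳ x)  ≈⟨ ∙-congˡ (foldr-∷ʳ ys x) ⟩
    y ∙ (foldr _∙_ ε ys ∙ x)   ≈⟨ assoc y _ x ⟨
    (y ∙ foldr _∙_ ε ys) ∙ x   ∎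

module FilteredProduct (M : Monoid c ℓ) {P : Pred ℕ p} (P? : Decidable P) (f : ℕ → Monoid.Carrier M) where
  open Monoid M using (Carrier; _≈_; _∙_; ε; setoid)
  open SetoidReasoning setoid

  ∏upTo : ℕ → Carrier
  ∏upTo m = foldr _∙_ ε (map f (filter P? (upTo m)))

  ∏upTo-suc-accept : ∀ m → P m → ∏upTo (suc m) ≈ ∏upTo m ∙ f m
  ∏upTo-suc-accept m Pm = begin
    foldr _∙_ ε (map f (filter P? (upTo (suc m))))   ≡⟨ cong (foldr _∙_ ε ∘ map f ∘ filter P?) (upTo-∷ʳ m) ⟨
    foldr _∙_ ε (map f (filter P? (upTo m ∷ʳ m)))    ≡⟨ cong (foldr _∙_ ε ∘ map f) (filter-∷ʳ-accept P? (upTo m) Pm) ⟩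
    foldr _∙_ ε (map f (filter P? (upTo m) ∷ʳ m))    ≡⟨ cong (foldr _∙_ ε) (map-++ f (filter P? (upTo m)) (m ∷ [])) ⟩
    foldr _∙_ ε (map f (filter P? (upTo m)) ∷ʳ f m)  ≈⟨ foldr-∷ʳ M (map f (filter P? (upTo m))) (f m) ⟩
    ∏upTo m ∙ f m                                     ∎

  ∏upTo-suc-reject : ∀ m → ¬ P m → ∏upTo (suc m) ≡ ∏upTo m
  ∏upTo-suc-reject m ¬Pm = ≡.trans (cong (foldr _∙_ ε ∘ map f ∘ filter P?) (≡.sym (upTo-∷ʳ m)))
                                      (cong (foldr _∙_ ε ∘ map f) (filter-∷ʳ-reject P? (upTo m) ¬Pm))

module _ where
  open import Data.Nat using (_+_; _*_; _∸_; _^_; _%_; _/_; _<_; s≤s; z≤n)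
  open import Data.Nat.Properties
    using (*-suc; *-assoc; m≤n+m; n≤1+n; ≤-refl; +-mono-≤; +-monoʳ-≤; ∸-monoʳ-≤; m>n⇒m∸n≢0
          ; m+n≤o⇒m≤o∸n; *-distribˡ-∸; m≤m*n; ≤-<-trans; *-monoˡ-≤; *-monoʳ-≤; *-cancelʳ-≤
          ; *-monoˡ-<; *-monoʳ-<; *-cancelˡ-<; ≤ᵇ⇒≤; *-commutativeSemigroup; module ≤-Reasoning)
  open import Algebra.Properties.CommutativeSemigroup *-commutativeSemigroup
    using (interchange; xy∙z≈y∙xz; xy∙z≈xz∙y; x∙yz≈y∙xz; x∙yz≈xz∙y)
  open import Data.Nat.DivMod using (m≡m%n+[m/n]*n; [m+kn]%n≡m%n; m%n<n)
  open import Data.Nat.Tactic.RingSolver using (solve-∀)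
  open import Relation.Nullary.Decidable using (from-yes; from-no)

  [1+m]*[m∸[1+e]]≤m*[m∸e] : ∀ m e → suc m * (m ∸ suc e) ≤ m * (m ∸ e)
  [1+m]*[m∸[1+e]]≤m*[m∸e] zero    e       = z≤n
  [1+m]*[m∸[1+e]]≤m*[m∸e] (suc m) zero    = ≡.subst ((2 + m) * m ≤_) (square m) (n≤1+n _)
    where
    square : ∀ m → 1 + (2 + m) * m ≡ (1 + m) * (1 + m)
    square = solve-∀
  [1+m]*[m∸[1+e]]≤m*[m∸e] (suc m) (suc e) = +-mono-≤ (∸-monoʳ-≤ m (n≤1+n e)) ([1+m]*[m∸[1+e]]≤m*[m∸e] m e)

  [1+m]^e*[m∸e]≤m^e*m : ∀ e m → suc m ^ e * (m ∸ e) ≤ m ^ e * m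
  [1+m]^e*[m∸e]≤m^e*m zero    m = ≤-refl
  [1+m]^e*[m∸e]≤m^e*m (suc e) m = begin
    suc m * suc m ^ e * (m ∸ suc e)    ≡⟨ xy∙z≈y∙xz (suc m) (suc m ^ e) (m ∸ suc e) ⟩
    suc m ^ e * (suc m * (m ∸ suc e))  ≤⟨ *-monoʳ-≤ (suc m ^ e) ([1+m]*[m∸[1+e]]≤m*[m∸e] m e) ⟩
    suc m ^ e * (m * (m ∸ e))          ≡⟨ x∙yz≈y∙xz (suc m ^ e) m (m ∸ e) ⟩
    m * (suc m ^ e * (m ∸ e))          ≤⟨ *-monoʳ-≤ m ([1+m]^e*[m∸e]≤m^e*m e m) ⟩
    m * (m ^ e * m)                    ≡⟨ *-assoc m (m ^ e) m ⟨
    m * m ^ e * m                      ∎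
    where open ≤-Reasoning

  c*[1+m]^e≤d*m^e : ∀ e m c d → e < m → c * m ≤ d * (m ∸ e) → c * suc m ^ e ≤ d * m ^ e
  c*[1+m]^e≤d*m^e e m c d e<m cm≤d[m∸e] = *-cancelʳ-≤ _ _ (m ∸ e) (begin
    c * suc m ^ e * (m ∸ e)    ≡⟨ *-assoc c (suc m ^ e) (m ∸ e) ⟩
    c * (suc m ^ e * (m ∸ e))  ≤⟨ *-monoʳ-≤ c ([1+m]^e*[m∸e]≤m^e*m e m) ⟩
    c * (m ^ e * m)            ≡⟨ x∙yz≈xz∙y c (m ^ e) m ⟩
    c * m * m ^ e              ≤⟨ *-monoˡ-≤ (m ^ e) cm≤d[m∸e] ⟩
    d * (m ∸ e) * m ^ e        ≡⟨ xy∙z≈xz∙y d (m ∸ e) (m ^ e) ⟩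
    d * m ^ e * (m ∸ e)        ∎)
    where
    open ≤-Reasoning
    instance
      m∸e≢0 : NonZero (m ∸ e)
      m∸e≢0 = ℕ.≢-nonZero (m>n⇒m∸n≢0 e<m)

  ^-distribʳ-* : ∀ m n e → (m * n) ^ e ≡ m ^ e * n ^ e
  ^-distribʳ-* m n zero    = refl
  ^-distribʳ-* m n (suc e) = ≡.trans (cong (m * n *_) (^-distribʳ-* m n e)) (interchange m n (m ^ e) (n ^ e))

  *-ratio-^ : ∀ e {u v r r′ x y s t} → u * x ^ e ≤ v * r * y ^ e → r * s ^ e ≤ r′ * t ^ e →
              u * (x * s) ^ e ≤ v * r′ * (y * t) ^ e
  *-ratio-^ e {u} {v} {r} {r′} {x} {y} {s} {t} ux≤vry rs≤r′t = begin
    u * (x * s) ^ e            ≡⟨ cong (u *_) (^-distribʳ-* x s e) ⟩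
    u * (x ^ e * s ^ e)        ≡⟨ *-assoc u (x ^ e) (s ^ e) ⟨
    u * x ^ e * s ^ e          ≤⟨ *-monoˡ-≤ (s ^ e) ux≤vry ⟩
    v * r * y ^ e * s ^ e      ≡⟨ regroup v r (y ^ e) (s ^ e) ⟩
    v * y ^ e * (r * s ^ e)    ≤⟨ *-monoʳ-≤ (v * y ^ e) rs≤r′t ⟩
    v * y ^ e * (r′ * t ^ e)   ≡⟨ interchange v (y ^ e) r′ (t ^ e) ⟩
    v * r′ * (y ^ e * t ^ e)   ≡⟨ cong (v * r′ *_) (^-distribʳ-* y t e) ⟨
    v * r′ * (y * t) ^ e       ∎
    where
    open ≤-Reasoning
    regroup : ∀ a b c d → a * b * c * d ≡ a * c * (b * d)
    regroup = solve-∀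

  -- 1, 5, 7, 11, 13, …: the n-th positive integer prime to 6, counting from n = 0.
  coprimeTo6 : ℕ → ℕ
  coprimeTo6 n = suc (n % 2 + 3 * n)

  3n<coprimeTo6 : ∀ n → 3 * n < coprimeTo6 n
  3n<coprimeTo6 n = s≤s (m≤n+m (3 * n) (n % 2))

  n%2≡r⇒[i+3n]%6≡[i+3r]%6 : ∀ i n {r} → n % 2 ≡ r → (i + 3 * n) % 6 ≡ (i + 3 * r) % 6
  n%2≡r⇒[i+3n]%6≡[i+3r]%6 i n refl = begin
    (i + 3 * n) % 6                    ≡⟨ cong (λ m → (i + 3 * m) % 6) (m≡m%n+[m/n]*n n 2) ⟩
    (i + 3 * (n % 2 + n / 2 * 2)) % 6  ≡⟨ cong (_% 6) (regroup i (n % 2) (n / 2)) ⟩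
    (i + 3 * (n % 2) + n / 2 * 6) % 6  ≡⟨ [m+kn]%n≡m%n (i + 3 * (n % 2)) (n / 2) 6 ⟩
    (i + 3 * (n % 2)) % 6              ∎
    where
    open ≡-Reasoning
    regroup : ∀ i r q → i + 3 * (r + q * 2) ≡ i + 3 * r + q * 6
    regroup = solve-∀

  Cond-resp : ∀ m n → m % 6 ≡ n % 6 → Cond n → Cond m
  Cond-resp _ _ eq = Sum.map (≡.trans eq) (≡.trans eq)

  open FilteredProduct *-1-monoid cond? term

  module _ (n : ℕ) {r : ℕ} (n%2≡r : n % 2 ≡ r) where

    ∏upTo-accept : ∀ i → Cond (i + 3 * r) → ∏upTo (suc (i + 3 * n)) ≡ ∏upTo (i + 3 * n) ℚ.* term (i + 3 * n)
    ∏upTo-accept i = ∏upTo-suc-accept (i + 3 * n)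
                   ∘ Cond-resp (i + 3 * n) (i + 3 * r) (n%2≡r⇒[i+3n]%6≡[i+3r]%6 i n n%2≡r)

    ∏upTo-reject : ∀ i → ¬ Cond (i + 3 * r) → ∏upTo (suc (i + 3 * n)) ≡ ∏upTo (i + 3 * n)
    ∏upTo-reject i ¬cond = ∏upTo-suc-reject (i + 3 * n)
                             (¬cond ∘ Cond-resp (i + 3 * r) (i + 3 * n) (≡.sym (n%2≡r⇒[i+3n]%6≡[i+3r]%6 i n n%2≡r)))

  prodP-suc-residue : ∀ n {r} → n % 2 ≡ r → r < 2 → prodP (suc n) ≡ prodP n ℚ.* term (suc (r + 3 * n))
  prodP-suc-residue n {0} eq _ = begin
    ∏upTo (3 * suc n)                       ≡⟨ cong ∏upTo (*-suc 3 n) ⟩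
    ∏upTo (3 + 3 * n)                       ≡⟨ ∏upTo-reject n eq 2 (from-no (cond? 2)) ⟩
    ∏upTo (2 + 3 * n)                       ≡⟨ ∏upTo-accept n eq 1 (from-yes (cond? 1)) ⟩
    ∏upTo (1 + 3 * n) ℚ.* term (1 + 3 * n)  ≡⟨ cong (ℚ._* term (1 + 3 * n)) (∏upTo-reject n eq 0 (from-no (cond? 0))) ⟩
    ∏upTo (3 * n) ℚ.* term (1 + 3 * n)      ∎
    where open ≡-Reasoning
  prodP-suc-residue n {1} eq _ = begin
    ∏upTo (3 * suc n)                       ≡⟨ cong ∏upTo (*-suc 3 n) ⟩
    ∏upTo (3 + 3 * n)                       ≡⟨ ∏upTo-accept n eq 2 (from-yes (cond? 5)) ⟩
    ∏upTo (2 + 3 * n) ℚ.* term (2 + 3 * n)  ≡⟨ cong (ℚ._* term (2 + 3 * n)) (∏upTo-reject n eq 1 (from-no (cond? 4))) ⟩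
    ∏upTo (1 + 3 * n) ℚ.* term (2 + 3 * n)  ≡⟨ cong (ℚ._* term (2 + 3 * n)) (∏upTo-reject n eq 0 (from-no (cond? 3))) ⟩
    ∏upTo (3 * n) ℚ.* term (2 + 3 * n)      ∎
    where open ≡-Reasoning
  prodP-suc-residue n {suc (suc _)} _ (s≤s (s≤s ()))

  prodP-suc : ∀ n → prodP (suc n) ≡ prodP n ℚ.* term (coprimeTo6 n)
  prodP-suc n = prodP-suc-residue n refl (m%n<n n 2)

  [1+3q]*[1+3k]^9≤[1+3[1+q]]*[3k]^9 : ∀ q k → 3 * suc q < k →
                                      (1 + 3 * q) * suc (3 * k) ^ 9 ≤ (1 + 3 * suc q) * (3 * k) ^ 9
  [1+3q]*[1+3k]^9≤[1+3[1+q]]*[3k]^9 q k 3[1+q]<k =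
    c*[1+m]^e≤d*m^e 9 (3 * k) (1 + 3 * q) (1 + 3 * suc q) 9<3k
      (≡.subst ((1 + 3 * q) * (3 * k) ≤_) (≡.sym (*-distribˡ-∸ (1 + 3 * suc q) (3 * k) 9))
        (m+n≤o⇒m≤o∸n _ (begin
          (1 + 3 * q) * (3 * k) + (1 + 3 * suc q) * 9  ≤⟨ +-monoʳ-≤ _ (*-monoˡ-≤ 9 3[1+q]<k) ⟩
          (1 + 3 * q) * (3 * k) + k * 9                ≡⟨ collect q k ⟩
          (1 + 3 * suc q) * (3 * k)                    ∎)))
    where
    open ≤-Reasoning
    9<3k : 9 < 3 * k
    9<3k = *-monoʳ-< 3 (≤-<-trans (m≤m*n 3 (suc q)) 3[1+q]<k)
    collect : ∀ q k → (1 + 3 * q) * (3 * k) + k * 9 ≡ (1 + 3 * (1 + q)) * (3 * k)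
    collect = solve-∀

  num den : ℕ → ℕ
  num zero    = 1
  num (suc n) = num n * suc (3 * coprimeTo6 n)
  den zero    = 1
  den (suc n) = den n * (3 * coprimeTo6 n)

  den-nonZero : ∀ n → NonZero (den n)
  den-nonZero zero    = _
  den-nonZero (suc n) = m*n≢0 (den n) (3 * coprimeTo6 n) {{den-nonZero n}}

  -- P(N)^9 ≤ (3/2)^9 (3N − 2)/3 for N = 2 + p; it fails for N = 1.
  num-den-bound : ∀ p → 3 * 2 ^ 9 * num (2 + p) ^ 9 ≤ 3 ^ 9 * (1 + 3 * suc p) * den (2 + p) ^ 9
  num-den-bound zero    = ≤ᵇ⇒≤ _ _ tt
  num-den-bound (suc p) =
    *-ratio-^ 9 {u = 3 * 2 ^ 9} {v = 3 ^ 9} {r = 1 + 3 * suc p} {r′ = 1 + 3 * suc (suc p)}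
                {x = num N} {y = den N} {s = suc (3 * k)} {t = 3 * k}
      (num-den-bound p)
      ([1+3q]*[1+3k]^9≤[1+3[1+q]]*[3k]^9 (suc p) k (3n<coprimeTo6 N))
    where
    N k : ℕ
    N = 2 + p
    k = coprimeTo6 N

  num^9*2^9<3^9*n*den^9 : ∀ n → 1 ≤ n → num n ^ 9 * 2 ^ 9 < 3 ^ 9 * n * den n ^ 9
  num^9*2^9<3^9*n*den^9 (suc zero)      _ = ≤ᵇ⇒≤ _ _ tt
  num^9*2^9<3^9*n*den^9 (suc (suc p)) _ = *-cancelˡ-< 3 _ _ (begin-strict
    3 * (num N ^ 9 * 2 ^ 9)              ≡⟨ x∙yz≈xz∙y 3 (num N ^ 9) (2 ^ 9) ⟩
    3 * 2 ^ 9 * num N ^ 9                ≤⟨ num-den-bound p ⟩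
    3 ^ 9 * (1 + 3 * suc p) * den N ^ 9  <⟨ *-monoˡ-< (den N ^ 9) (*-monoʳ-< (3 ^ 9) 1+3[1+p]<3N) ⟩
    3 ^ 9 * (3 * N) * den N ^ 9          ≡⟨ regroup (3 ^ 9) N (den N ^ 9) ⟩
    3 * (3 ^ 9 * N * den N ^ 9)          ∎)
    where
    open ≤-Reasoning
    N : ℕ
    N = 2 + p
    instance
      den≢0 : NonZero (den N)
      den≢0 = den-nonZero N
      den^9≢0 : NonZero (den N ^ 9)
      den^9≢0 = m^n≢0 (den N) 9
    1+3[1+p]<3N : 1 + 3 * suc p < 3 * N
    1+3[1+p]<3N = ≡.subst (1 + 3 * suc p <_) (≡.sym (*-suc 3 (suc p))) (n≤1+n _)
    regroup : ∀ a b c → a * (3 * b) * c ≡ 3 * (a * b * c)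
    regroup = solve-∀

open import Data.Nat.Tactic.RingSolver using (solve)
open import Data.Rational using (_/_; _*_; _<_)

-- ℕ.pred makes d = 0 act as d = 1, so the lemmas below all assume NonZero d.
infix 4 _≃_/_
record _≃_/_ (x : ℚ.ℚ) (a d : ℕ) : Set where
  constructor fraction
  field toℚᵘ-≃ : ℚ.toℚᵘ x ≃ᵘ mkℚᵘ (+ a) (ℕ.pred d)

open _≃_/_ using (toℚᵘ-≃)

/-≃ : ∀ a d .{{_ : NonZero d}} → + a / d ≃ a / d
/-≃ a (suc d) = fraction (toℚᵘ-fromℚᵘ (mkℚᵘ (+ a) d))

*-≃ : ∀ {x y a b c d} .{{_ : NonZero b}} .{{_ : NonZero d}} →
      x ≃ a / b → y ≃ c / d → x * y ≃ a ℕ.* c / b ℕ.* d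
*-≃ {x} {y} {a} {suc _} {c} {suc _} (fraction x≃a/b) (fraction y≃c/d) = fraction
  (≃-trans (toℚᵘ-homo-* x y)
  (≃-trans (ℚᵘ.*-cong x≃a/b y≃c/d)
           (≃-reflexive (cong (λ z → mkℚᵘ z _) (≡.sym (pos-* a c))))))

^-≃ : ∀ {x a b} .{{_ : NonZero b}} → x ≃ a / b → ∀ e → x ^ℚ e ≃ a ℕ.^ e / b ℕ.^ e
^-≃ x≃a/b zero            = fraction ≃-refl
^-≃ {b = b} x≃a/b (suc e) = *-≃ x≃a/b (^-≃ x≃a/b e)
  where
  instance
    b^e≢0 : NonZero (b ℕ.^ e)
    b^e≢0 = m^n≢0 b e

≃-< : ∀ {x y a b c d} .{{_ : NonZero b}} .{{_ : NonZero d}} →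
      x ≃ a / b → y ≃ c / d → a ℕ.* d ℕ.< c ℕ.* b → x < y
≃-< {a = a} {suc b} {c} {suc d} (fraction x≃a/b) (fraction y≃c/d) ad<cb = toℚᵘ-cancel-<
  (<-respˡ-≃ (≃-sym x≃a/b) (<-respʳ-≃ (≃-sym y≃c/d)
    (*<* (≡.subst₂ ℤ._<_ (pos-* a (suc d)) (pos-* c (suc b)) (+<+ ad<cb)))))

term-≃ : ∀ k .{{_ : NonZero k}} → term k ≃ suc (3 ℕ.* k) / 3 ℕ.* k
term-≃ (suc j) = fraction
  (≃-trans (toℚᵘ-homo-+ 1ℚ (+ 1 / (3 ℕ.* suc j)))
  (≃-trans (ℚᵘ.+-congʳ (ℚ.toℚᵘ 1ℚ) (toℚᵘ-≃ (/-≃ 1 (3 ℕ.* suc j))))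
           (*≡* (cong +_ (solve (j ∷ []))))))

prodP-≃ : ∀ n → prodP n ≃ num n / den n
prodP-≃ zero    = fraction ≃-refl
prodP-≃ (suc n) rewrite prodP-suc n = *-≃ (prodP-≃ n) (term-≃ (coprimeTo6 n))
  where
  instance
    den≢0 : NonZero (den n)
    den≢0 = den-nonZero n

lemma4p5 : (n : ℕ) → 1 ≤ n → (prodP n) ^ℚ 9 < ((+ 3 / 2) ^ℚ 9) * (+ n / 1)
lemma4p5 n 1≤n = ≃-< (^-≃ (prodP-≃ n) 9) (*-≃ (^-≃ (/-≃ 3 2) 9) (/-≃ n 1)) (num^9*2^9<3^9*n*den^9 n 1≤n)
  where
  instance
    den≢0 : NonZero (den n)
    den≢0 = den-nonZero n
    den^9≢0 : NonZero (den n ℕ.^ 9)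
    den^9≢0 = m^n≢0 (den n) 9
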